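{- The homotopy category of the core model structure on $\mathcal{G}$ (that is, the localization of $\mathcal{G}$ at the homomorphisms inducing isomorphisms on cores) is equivalent to the category $\mathcal{G}_{core}$.
   Context: A graph is a finite set of vertices with a symmetric binary relation (loops allowed, no multiple edges); homomorphisms are vertex maps sending edges to edges. $\mathcal{G}$ is the category with one representative of each isomorphism class of finite graphs and homomorphisms as morphisms. A retraction is a morphism $r:A\to B$ with some $s:B\to A$ such that $r\circ s=1_B$. The core $G_{core}$ of $G$ is a retract of $G$ with fewest vertices (unique up to isomorphism); a graph is a core if it has no retract with fewer vertices. A homomorphism $f:G\to H$ induces an isomorphism on cores if $r_H\circ f\circ s_G:G_{core}\to H_{core}$ is an isomorphism, where $s_G$ is a section $G_{core}\to G$ and $r_H$ a retraction $H\to H_{core}$. The core model structure on $\mathcal{G}$ has as weak equivalences the homomorphisms inducing isomorphisms on cores, as cofibrations the canonical injections into a coproduct, and as fibrations the morphisms having the right lifting property with respect to all cofibrations that are weak equivalences. The homotopy category of a model category is its localization at the weak equivalences. $\mathcal{G}_{core}$ is the poset, viewed as a category, whose elements are the graphs of $\mathcal{G}$ that are cores, ordered by $G\geq H$ if and only if there exists a homomorphism $G\to H$. -}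

module Defs where

open import Data.Nat using (ℕ; _≤_)
open import Data.Fin using (Fin)
open import Data.Bool using (Bool; true)
open import Data.Unit using (⊤; tt)
open import Data.Product using (Σ; _×_; _,_; proj₁; proj₂)
open import Function using () renaming (_∘_ to _∘′_; id to idF)
open import Relation.Binary.PropositionalEquality
  using (_≡_; refl; sym; trans; cong; subst)

-- Finite graphs: vertex set Fin V, symmetric (decidable) edge relation,
-- loops allowed, no multiple edges.

record Graph : Set where
  field
    V     : ℕ
    E     : Fin V → Fin V → Bool
    E-sym : ∀ i j → E i j ≡ E j i
open Graph public

record Hom (G H : Graph) : Set where
  constructor hom
  field
    fun  : Fin (V G) → Fin (V H)
    pres : ∀ i j → E G i j ≡ true → E H (fun i) (fun j) ≡ true
open Hom public

idH : ∀ {G} → Hom G G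
idH = hom idF (λ i j e → e)

_∘H_ : ∀ {G H K} → Hom H K → Hom G H → Hom G K
g ∘H f = hom (fun g ∘′ fun f) (λ i j e → pres g _ _ (pres f i j e))

_≗H_ : ∀ {G H} → Hom G H → Hom G H → Set
f ≗H g = ∀ i → fun f i ≡ fun g i

IsCore : Graph → Set
IsCore G = ∀ (H : Graph) (r : Hom G H) (s : Hom H G) →
           (r ∘H s) ≗H idH → V G ≤ V H

record CoreOf (G : Graph) : Set where
  field
    C       : Graph
    r       : Hom G C
    s       : Hom C G
    r∘s≗id  : (r ∘H s) ≗H idH
    fewest  : ∀ (H : Graph) (r' : Hom G H) (s' : Hom H G) →
              (r' ∘H s') ≗H idH → V C ≤ V H
open CoreOf public

IsIso : ∀ {G H} → Hom G H → Set
IsIso {G} {H} h = Σ (Hom H G) λ g → ((g ∘H h) ≗H idH) × ((h ∘H g) ≗H idH)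

-- f : G → H induces an isomorphism on cores: r_H ∘ f ∘ s_G is an iso
-- (for some choice of cores / section / retraction; by uniqueness of
-- cores up to isomorphism this does not depend on the choice).
WeakEq : ∀ {G H} → Hom G H → Set
WeakEq {G} {H} f =
  Σ (CoreOf G) λ cG → Σ (CoreOf H) λ cH → IsIso (r cH ∘H (f ∘H s cG))

record Category : Set₁ where
  infixr 9 _∘_
  infix 4 _≈_
  field
    Obj   : Set
    _⇒_   : Obj → Obj → Set
    _≈_   : ∀ {A B} → A ⇒ B → A ⇒ B → Set
    ≈-refl  : ∀ {A B} {f : A ⇒ B} → f ≈ f
    ≈-sym   : ∀ {A B} {f g : A ⇒ B} → f ≈ g → g ≈ f
    ≈-trans : ∀ {A B} {f g h : A ⇒ B} → f ≈ g → g ≈ h → f ≈ h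
    idC   : ∀ {A} → A ⇒ A
    _∘_   : ∀ {A B C} → B ⇒ C → A ⇒ B → A ⇒ C
    assoc : ∀ {A B C D} {f : A ⇒ B} {g : B ⇒ C} {h : C ⇒ D} →
            (h ∘ g) ∘ f ≈ h ∘ (g ∘ f)
    identityˡ : ∀ {A B} {f : A ⇒ B} → idC ∘ f ≈ f
    identityʳ : ∀ {A B} {f : A ⇒ B} → f ∘ idC ≈ f
    ∘-resp-≈  : ∀ {A B C} {f f' : A ⇒ B} {g g' : B ⇒ C} →
                g ≈ g' → f ≈ f' → g ∘ f ≈ g' ∘ f'

record Functor (𝒞 𝒟 : Category) : Set where
  private
    module C = Category 𝒞
    module D = Category 𝒟
  field
    F₀ : C.Obj → D.Obj
    F₁ : ∀ {A B} → A C.⇒ B → F₀ A D.⇒ F₀ B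
    F-resp-≈ : ∀ {A B} {f g : A C.⇒ B} → f C.≈ g → F₁ f D.≈ F₁ g
    F-id : ∀ {A} → F₁ (C.idC {A}) D.≈ D.idC
    F-∘  : ∀ {A B K} {f : A C.⇒ B} {g : B C.⇒ K} →
           F₁ (g C.∘ f) D.≈ F₁ g D.∘ F₁ f

record Equivalence (𝒞 𝒟 : Category) : Set where
  private
    module C = Category 𝒞
    module D = Category 𝒟
  field
    F : Functor 𝒞 𝒟
    G : Functor 𝒟 𝒞
  private
    module F = Functor F
    module G = Functor G
  field
    η     : ∀ X → X C.⇒ G.F₀ (F.F₀ X)
    η⁻¹   : ∀ X → G.F₀ (F.F₀ X) C.⇒ X
    η-iso₁ : ∀ X → η⁻¹ X C.∘ η X C.≈ C.idC
    η-iso₂ : ∀ X → η X C.∘ η⁻¹ X C.≈ C.idC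
    η-nat : ∀ {X Y} (f : X C.⇒ Y) →
            η Y C.∘ f C.≈ G.F₁ (F.F₁ f) C.∘ η X
    ε     : ∀ Y → F.F₀ (G.F₀ Y) D.⇒ Y
    ε⁻¹   : ∀ Y → Y D.⇒ F.F₀ (G.F₀ Y)
    ε-iso₁ : ∀ Y → ε⁻¹ Y D.∘ ε Y D.≈ D.idC
    ε-iso₂ : ∀ Y → ε Y D.∘ ε⁻¹ Y D.≈ D.idC
    ε-nat : ∀ {X Y} (f : X D.⇒ Y) →
            ε Y D.∘ F.F₁ (G.F₁ f) D.≈ f D.∘ ε X

-- The localization of the graph category at the weak equivalences
-- (= homotopy category of the core model structure).
-- Morphisms: zigzag paths of homomorphisms and formal inverses of weak
-- equivalences, modulo the congruence generated by the relations of 𝒢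
-- and the inverse relations.

data Step : Graph → Graph → Set where
  fwd : ∀ {G H} → Hom G H → Step G H
  bwd : ∀ {G H} (w : Hom H G) → WeakEq w → Step G H

-- paths in diagrammatic order: s ∷ p means "first s, then p"
data Path : Graph → Graph → Set where
  []  : ∀ {G} → Path G G
  _∷_ : ∀ {G H K} → Step G H → Path H K → Path G K

infixr 5 _∷_ _++_
_++_ : ∀ {G H K} → Path G H → Path H K → Path G K
[] ++ q = q
(s ∷ p) ++ q = s ∷ (p ++ q)

infix 4 _∼_
data _∼_ : ∀ {G H} → Path G H → Path G H → Set where
  ∼-refl  : ∀ {G H} {p : Path G H} → p ∼ p
  ∼-sym   : ∀ {G H} {p q : Path G H} → p ∼ q → q ∼ p
  ∼-trans : ∀ {G H} {p q r : Path G H} → p ∼ q → q ∼ r → p ∼ r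
  ∼-ctx   : ∀ {X A B Y} (l : Path X A) {p q : Path A B} (r : Path B Y) →
            p ∼ q → l ++ (p ++ r) ∼ l ++ (q ++ r)
  fwd-ext : ∀ {G H} {f g : Hom G H} → f ≗H g → fwd f ∷ [] ∼ fwd g ∷ []
  bwd-ext : ∀ {G H} {w w' : Hom H G} (a : WeakEq w) (b : WeakEq w') →
            w ≗H w' → bwd w a ∷ [] ∼ bwd w' b ∷ []
  fwd-id  : ∀ {G} → fwd (idH {G}) ∷ [] ∼ []
  fwd-∘   : ∀ {G H K} (f : Hom G H) (g : Hom H K) →
            fwd f ∷ fwd g ∷ [] ∼ fwd (g ∘H f) ∷ []
  inv₁    : ∀ {G H} (w : Hom G H) (a : WeakEq w) →
            fwd w ∷ bwd w a ∷ [] ∼ []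
  inv₂    : ∀ {G H} (w : Hom G H) (a : WeakEq w) →
            bwd w a ∷ fwd w ∷ [] ∼ []

++-[] : ∀ {G H} (p : Path G H) → p ++ [] ≡ p
++-[] [] = refl
++-[] (s ∷ p) = cong (s ∷_) (++-[] p)

++-assoc : ∀ {A B C D} (p : Path A B) (q : Path B C) (r : Path C D) →
           (p ++ q) ++ r ≡ p ++ (q ++ r)
++-assoc [] q r = refl
++-assoc (s ∷ p) q r = cong (s ∷_) (++-assoc p q r)

≡⇒∼ : ∀ {G H} {p q : Path G H} → p ≡ q → p ∼ q
≡⇒∼ refl = ∼-refl

∼-left : ∀ {A B Y} {p q : Path A B} (r : Path B Y) → p ∼ q → p ++ r ∼ q ++ r
∼-left r e = ∼-ctx [] r e

∼-right : ∀ {X A B} (l : Path X A) {p q : Path A B} → p ∼ q → l ++ p ∼ l ++ q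
∼-right l {p} {q} e =
  ∼-trans (≡⇒∼ (cong (l ++_) (sym (++-[] p))))
    (∼-trans (∼-ctx l [] e) (≡⇒∼ (cong (l ++_) (++-[] q))))

HoG : Category
HoG = record
  { Obj = Graph
  ; _⇒_ = Path
  ; _≈_ = _∼_
  ; ≈-refl = ∼-refl
  ; ≈-sym = ∼-sym
  ; ≈-trans = ∼-trans
  ; idC = []
  ; _∘_ = λ q p → p ++ q
  ; assoc = λ {_} {_} {_} {_} {f} {g} {h} → ≡⇒∼ (sym (++-assoc f g h))
  ; identityˡ = λ {_} {_} {f} → ≡⇒∼ (++-[] f)
  ; identityʳ = ∼-refl
  ; ∘-resp-≈ = λ {_} {_} {_} {f} {f'} {g} {g'} eg ef →
      ∼-trans (∼-left g ef) (∼-right f' eg)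
  }

-- 𝒢_core: cores, with G ≥ H iff there is a homomorphism G → H
-- (a thin category: all parallel morphisms are equal).

CoreObj : Set
CoreObj = Σ Graph IsCore

GCore : Category
GCore = record
  { Obj = CoreObj
  ; _⇒_ = λ A B → Hom (proj₁ A) (proj₁ B)
  ; _≈_ = λ _ _ → ⊤
  ; ≈-refl = tt
  ; ≈-sym = λ _ → tt
  ; ≈-trans = λ _ _ → tt
  ; idC = idH
  ; _∘_ = _∘H_
  ; assoc = tt
  ; identityˡ = tt
  ; identityʳ = tt
  ; ∘-resp-≈ = λ _ _ → tt
  }

-- The heart of the argument is that HoG is thin.  For parallel homomorphisms
-- f, g : A → B, the codiagonal ∇ : A + A → A is a weak equivalence, so both
-- injections equal its formal inverse and f = [f,g] ∘ inl ∼ [f,g] ∘ inr = g.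
-- Every zigzag then collapses to one homomorphism, since a weak equivalence
-- G → H has some homomorphism H → G, which by thinness is its inverse.  The
-- equivalence sends a graph to its core; both round trips are retractions
-- onto cores and their sections.
--
-- To see that ∇ is a weak equivalence we show that homomorphisms in both
-- directions between cores are isomorphisms.  This rests on: an endomorphism
-- e of a core is an automorphism, because e^(n!) is idempotent and an
-- idempotent other than the identity splits through a smaller retract.
-- Cores exist since splittings through m vertices are decidable by search.

module Submission where

open import Defs
open import Data.Nat using (ℕ; zero; suc; pred; _+_; _*_; _∸_; _≤_; _<_; z≤n; s≤s; s≤s⁻¹; _!)
open import Data.Nat.Properties
  using (≤-refl; ≤-trans; <⇒≤; <⇒≱; n<1+n; +-comm; m∸n≤m; m∸n+n≡m; m<n⇒0<n∸m; suc-pred; _!≢0)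
open import Data.Nat.Divisibility using (_∣_; ∣-trans; m∣m*n; m≤n⇒m!∣n!; ∣⇒≤)
open import Data.Nat.GeneralisedArithmetic using (fold; fold-+)
open import Data.Fin using (Fin; zero; suc; toℕ; punchIn; punchOut; splitAt; _↑ˡ_; _↑ʳ_)
open import Data.Fin.Properties
  using (pigeonhole; toℕ<n; punchIn-punchOut; punchOut-cong; any?; all?; ¬∀⟶∃¬; splitAt-↑ˡ; splitAt-↑ʳ)
  renaming (_≟_ to _≟F_)
open import Data.Vec.Functional using (head; tail) renaming (_∷_ to _◂_)
open import Data.Bool using (Bool; true; false) renaming (_≟_ to _≟B_)
open import Data.Sum using (_⊎_; inj₁; inj₂; [_,_]′)
open import Data.Product using (Σ; _×_; _,_; proj₁; proj₂)
open import Data.Unit using (tt)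
open import Data.Empty using (⊥-elim)
open import Relation.Nullary using (Dec; yes; no)
open import Relation.Nullary.Decidable using (_×-dec_; _→-dec_)
open import Relation.Binary.Bundles using (Setoid)
open import Relation.Binary.PropositionalEquality
import Relation.Binary.Reasoning.Setoid as SetoidReasoning

-- 1 ≤ p ≤ N implies p ∣ N!: the exponent N! is a common period of all cycles
-- of a self-map of an N-element set.
∣-factorial : ∀ {p N} → 1 ≤ p → p ≤ N → p ∣ N !
∣-factorial {suc p} _ p≤N = ∣-trans (m∣m*n (p !)) (m≤n⇒m!∣n! p≤N)

-- N ≤ N!: after N! steps every orbit of such a map has reached its cycle.
≤-factorial : ∀ N → N ≤ N !
≤-factorial zero = z≤n
≤-factorial (suc N) = ∣⇒≤ {{suc N !≢0}} (∣-factorial (s≤s z≤n) ≤-refl)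

-- The iterates f^n x are written  fold x f n.
module EventualIdempotence {N : ℕ} (f : Fin N → Fin N) where
  open ≡-Reasoning

  cycle-multiple : ∀ {y} p → fold y f p ≡ y → ∀ q → fold y f (q * p) ≡ y
  cycle-multiple p cyc zero = refl
  cycle-multiple {y} p cyc (suc q) = begin
    fold y f (p + q * p)          ≡⟨ fold-+ y f p ⟩
    fold (fold y f (q * p)) f p   ≡⟨ cong (λ z → fold z f p) (cycle-multiple p cyc q) ⟩
    fold y f p                    ≡⟨ cyc ⟩
    y                             ∎

  cycle-shift : ∀ {y} p → fold y f p ≡ y → ∀ d → fold (fold y f d) f p ≡ fold y f d
  cycle-shift {y} p cyc d = begin
    fold (fold y f d) f p   ≡⟨ fold-+ y f p ⟨
    fold y f (p + d)        ≡⟨ cong (fold y f) (+-comm p d) ⟩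
    fold y f (d + p)        ≡⟨ fold-+ y f d ⟩
    fold (fold y f p) f d   ≡⟨ cong (λ z → fold z f d) cyc ⟩
    fold y f d              ∎

  record EntersCycle (x : Fin N) : Set where
    field
      tail-length period : ℕ
      tail≤N     : tail-length ≤ N
      1≤period   : 1 ≤ period
      period≤N   : period ≤ N
      cycles     : fold (fold x f tail-length) f period ≡ fold x f tail-length

  entersCycle : ∀ x → EntersCycle x
  entersCycle x with pigeonhole (n<1+n N) (λ i → fold x f (toℕ i))
  ... | i , j , i<j , fᵢ≡fⱼ = record
    { tail-length = toℕ i
    ; period      = toℕ j ∸ toℕ i
    ; tail≤N      = s≤s⁻¹ (toℕ<n i)
    ; 1≤period    = m<n⇒0<n∸m i<j
    ; period≤N    = ≤-trans (m∸n≤m (toℕ j) (toℕ i)) (s≤s⁻¹ (toℕ<n j))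
    ; cycles      = begin
        fold (fold x f (toℕ i)) f (toℕ j ∸ toℕ i)   ≡⟨ fold-+ x f (toℕ j ∸ toℕ i) ⟨
        fold x f (toℕ j ∸ toℕ i + toℕ i)            ≡⟨ cong (fold x f) (m∸n+n≡m (<⇒≤ i<j)) ⟩
        fold x f (toℕ j)                            ≡⟨ fᵢ≡fⱼ ⟨
        fold x f (toℕ i)                            ∎
    }

  K : ℕ
  K = N !

  -- f^K is idempotent: f^K x lies on its cycle, whose length divides K.
  idempotent : ∀ x → fold (fold x f K) f K ≡ fold x f K
  idempotent x = begin
    fold z f K         ≡⟨ cong (fold z f) K≡q*p ⟩
    fold z f (q * p)   ≡⟨ cycle-multiple p z-cycles q ⟩
    z                  ∎
    where
    open EntersCycle (entersCycle x) renaming (tail-length to a; period to p)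
    open _∣_ (∣-factorial 1≤period period≤N) renaming (quotient to q; equality to K≡q*p)
    z : Fin N
    z = fold x f K
    z-onCycle : fold (fold x f a) f (K ∸ a) ≡ z
    z-onCycle = trans (sym (fold-+ x f (K ∸ a)))
                      (cong (fold x f) (m∸n+n≡m (≤-trans tail≤N (≤-factorial N))))
    z-cycles : fold z f p ≡ z
    z-cycles = subst (λ w → fold w f p ≡ w) z-onCycle (cycle-shift p cycles (K ∸ a))

Idempotent : ∀ {n} → (Fin n → Fin n) → Set
Idempotent g = ∀ x → g (g x) ≡ g x

record Split {n} (g : Fin n → Fin n) (m : ℕ) : Set where
  field
    retr      : Fin n → Fin m
    sect      : Fin m → Fin n
    retr∘sect : ∀ i → retr (sect i) ≡ i
    sect∘retr : ∀ x → sect (retr x) ≡ g x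

-- An idempotent moving a point x misses x, so it restricts to the remaining
-- points; a splitting of the restriction is a splitting of g.
module DeletePoint {n} (g : Fin (suc n) → Fin (suc n)) (idem : Idempotent g)
                   (x : Fin (suc n)) (gx≢x : g x ≢ x) where
  x∉image : ∀ y → x ≢ g y
  x∉image y x≡gy = gx≢x (trans (cong g x≡gy) (trans (idem y) (sym x≡gy)))

  g′ : Fin n → Fin n
  g′ i = punchOut (x∉image (punchIn x i))

  punchIn-g′ : ∀ i → punchIn x (g′ i) ≡ g (punchIn x i)
  punchIn-g′ i = punchIn-punchOut (x∉image (punchIn x i))

  idem′ : Idempotent g′
  idem′ i = punchOut-cong x (trans (cong g (punchIn-g′ i)) (idem (punchIn x i)))

  lift : ∀ {m} → Split g′ m → Split g m
  lift sp = record
    { retr      = λ y → retr (punchOut (x∉image y))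
    ; sect      = λ i → punchIn x (sect i)
    ; retr∘sect = λ i → trans (cong retr (sym (sect∘retr (sect i))))
                              (trans (retr∘sect (retr (sect i))) (retr∘sect i))
    ; sect∘retr = λ y → let y′ = punchOut (x∉image y) in begin
        punchIn x (sect (retr y′))    ≡⟨ cong (punchIn x) (sect∘retr y′) ⟩
        punchIn x (g′ y′)             ≡⟨ punchIn-g′ y′ ⟩
        g (punchIn x y′)              ≡⟨ cong g (punchIn-punchOut (x∉image y)) ⟩
        g (g y)                       ≡⟨ idem y ⟩
        g y                           ∎
    }
    where
    open Split sp
    open ≡-Reasoning

mutual
  split : ∀ {n} (g : Fin n → Fin n) → Idempotent g → Σ ℕ λ m → m ≤ n × Split g m
  split {n} g idem with all? (λ x → g x ≟F x)
  ... | yes fixed = n , ≤-refl , record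
    { retr = λ x → x ; sect = λ i → i ; retr∘sect = λ i → refl ; sect∘retr = λ x → sym (fixed x) }
  ... | no ¬fixed with ¬∀⟶∃¬ n (λ x → g x ≡ x) (λ x → g x ≟F x) ¬fixed
  ...   | x , gx≢x with splitProper g idem x gx≢x
  ...     | m , m<n , sp = m , <⇒≤ m<n , sp

  splitProper : ∀ {n} (g : Fin n → Fin n) → Idempotent g → (x : Fin n) → g x ≢ x →
                Σ ℕ λ m → m < n × Split g m
  splitProper {suc n} g idem x gx≢x with split g′ idem′
    where open DeletePoint g idem x gx≢x
  ... | m , m≤n , sp = m , s≤s m≤n , DeletePoint.lift g idem x gx≢x sp

-- Vertex maps r : G → m, s : m → G with r ∘ s = id and s ∘ r a graph
-- endomorphism: exactly the data of a retract of G on m vertices.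
IsSplitting : (G : Graph) {m : ℕ} → (Fin (V G) → Fin m) → (Fin m → Fin (V G)) → Set
IsSplitting G rv sv = (∀ i → rv (sv i) ≡ i)
                    × (∀ a b → E G a b ≡ true → E G (sv (rv a)) (sv (rv b)) ≡ true)

Splitting : Graph → ℕ → Set
Splitting G m = Σ (Fin (V G) → Fin m) λ rv → Σ (Fin m → Fin (V G)) λ sv → IsSplitting G rv sv

induced : (G : Graph) {m : ℕ} → (Fin m → Fin (V G)) → Graph
induced G {m} sv = record
  { V = m ; E = λ i j → E G (sv i) (sv j) ; E-sym = λ i j → E-sym G (sv i) (sv j) }

module Retract {G : Graph} {m : ℕ} (sp : Splitting G m) where
  graph : Graph
  graph = induced G (proj₁ (proj₂ sp))

  retraction : Hom G graph
  retraction = hom (proj₁ sp) (proj₂ (proj₂ (proj₂ sp)))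

  section : Hom graph G
  section = hom (proj₁ (proj₂ sp)) (λ i j e → e)

  retraction∘section : (retraction ∘H section) ≗H idH
  retraction∘section = proj₁ (proj₂ (proj₂ sp))

retract⇒splitting : ∀ {G H} (rh : Hom G H) (sh : Hom H G) → (rh ∘H sh) ≗H idH →
                    Splitting G (V H)
retract⇒splitting rh sh rh∘sh≗id =
  fun rh , fun sh , rh∘sh≗id , λ a b e → pres sh _ _ (pres rh a b e)

idempotentSplitting : ∀ {G m} (g : Hom G G) → Split (fun g) m → Splitting G m
idempotentSplitting {G} g sp = retr , sect , retr∘sect , λ a b e →
  subst₂ (λ u v → E G u v ≡ true) (sym (sect∘retr a)) (sym (sect∘retr b)) (pres g a b e)
  where open Split sp

Extensional : ∀ {a b} → ((Fin a → Fin b) → Set) → Set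
Extensional P = ∀ {f g} → (∀ i → f i ≡ g i) → P f → P g

anyFunction? : ∀ a {b} (P : (Fin a → Fin b) → Set) → Extensional P → (∀ f → Dec (P f)) →
               Dec (Σ (Fin a → Fin b) P)
anyFunction? zero P ext P? with P? (λ ())
... | yes p = yes ((λ ()) , p)
... | no ¬p = no λ { (f , pf) → ¬p (ext (λ ()) pf) }
anyFunction? (suc a) P ext P?
  with any? (λ y → anyFunction? a (λ f → P (y ◂ f))
                     (λ eq → ext λ { zero → refl ; (suc i) → eq i })
                     (λ f → P? (y ◂ f)))
... | yes (y , f , p) = yes ((y ◂ f) , p)
... | no ¬p = no λ { (f , pf) →
  ¬p (head f , tail f , ext (λ { zero → refl ; (suc i) → refl }) pf) }

splitting? : ∀ G m → Dec (Splitting G m)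
splitting? G m =
  anyFunction? (V G) _ (λ eq (sv , sp) → sv , respect eq (λ i → refl) sp) λ rv →
  anyFunction? m _ (λ eq sp → respect (λ i → refl) eq sp) λ sv →
  all? (λ i → rv (sv i) ≟F i) ×-dec
  all? (λ a → all? (λ b → (E G a b ≟B true) →-dec (E G (sv (rv a)) (sv (rv b)) ≟B true)))
  where
  respect : ∀ {m} {rv rv′ : Fin (V G) → Fin m} {sv sv′ : Fin m → Fin (V G)} →
            (∀ a → rv a ≡ rv′ a) → (∀ i → sv i ≡ sv′ i) →
            IsSplitting G rv sv → IsSplitting G rv′ sv′
  respect {rv = rv} {rv′} {sv} {sv′} eqr eqs (rs , srp) =
    (λ i → trans (cong rv′ (sym (eqs i))) (trans (sym (eqr (sv i))) (rs i))) ,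
    (λ a b e → subst₂ (λ u v → E G u v ≡ true)
                 (trans (cong sv (eqr a)) (eqs (rv′ a))) (trans (cong sv (eqr b)) (eqs (rv′ b)))
                 (srp a b e))

least : {P : ℕ → Set} → (∀ n → Dec (P n)) → ∀ n → P n → Σ ℕ λ m → P m × (∀ k → P k → m ≤ k)
least P? zero p = zero , p , λ k _ → z≤n
least P? (suc n) p with P? zero
... | yes p₀ = zero , p₀ , λ k _ → z≤n
... | no ¬p₀ with least (λ k → P? (suc k)) n p
...   | m , pm , minimal =
  suc m , pm , λ { zero p₀ → ⊥-elim (¬p₀ p₀) ; (suc k) pk → s≤s (minimal k pk) }

coreOf : (G : Graph) → CoreOf G
coreOf G with least (splitting? G) (V G) ((λ x → x) , (λ x → x) , (λ i → refl) , λ a b e → e)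
... | m , sp , minimal = record
  { C      = graph
  ; r      = retraction
  ; s      = section
  ; r∘s≗id = retraction∘section
  ; fewest = λ H rh sh eq → minimal (V H) (retract⇒splitting rh sh eq)
  }
  where open Retract sp

-- A core of G is a core: its retracts are retracts of G.
isCoreOf : ∀ {G} (c : CoreOf G) → IsCore (C c)
isCoreOf c H rh sh eq =
  fewest c H (rh ∘H r c) (s c ∘H sh) (λ i → trans (cong (fun rh) (r∘s≗id c (fun sh i))) (eq i))

power : ∀ {G} → Hom G G → ℕ → Hom G G
power {G} e n = hom (λ x → fold x (fun e) n) (pres-power n)
  where
  pres-power : ∀ n i j → E G i j ≡ true → E G (fold i (fun e) n) (fold j (fun e) n) ≡ true
  pres-power zero i j eij = eij
  pres-power (suc n) i j eij = pres e _ _ (pres-power n i j eij)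

-- In a core every idempotent endomorphism is the identity: one moving a
-- vertex would split through a retract with fewer vertices.
core-idempotent≗id : ∀ {G} → IsCore G → (g : Hom G G) → Idempotent (fun g) → g ≗H idH
core-idempotent≗id isCore g idem x with fun g x ≟F x
... | yes gx≡x = gx≡x
... | no gx≢x with splitProper (fun g) idem x gx≢x
...   | m , m<n , sp = ⊥-elim (<⇒≱ m<n (isCore graph retraction section retraction∘section))
  where open Retract (idempotentSplitting g sp)

-- Every endomorphism e of a core is an automorphism: e^(n!) is idempotent,
-- hence the identity, so e^(n! - 1) inverts e.
coreEndoIso : ∀ {G} → IsCore G → (e : Hom G G) → IsIso e
coreEndoIso {G} isCore e = power e k , inverseˡ , inverseʳ
  where
  open EventualIdempotence (fun e)
  open ≡-Reasoning
  k : ℕ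
  k = pred K
  e^K≗id : ∀ x → fold x (fun e) (suc k) ≡ x
  e^K≗id x = trans (cong (fold x (fun e)) (suc-pred K {{V G !≢0}}))
                   (core-idempotent≗id isCore (power e K) idempotent x)
  inverseˡ : ∀ x → fold (fun e x) (fun e) k ≡ x
  inverseˡ x = begin
    fold (fun e x) (fun e) k   ≡⟨ fold-+ x (fun e) k ⟨
    fold x (fun e) (k + 1)     ≡⟨ cong (fold x (fun e)) (+-comm k 1) ⟩
    fold x (fun e) (suc k)     ≡⟨ e^K≗id x ⟩
    x                          ∎
  inverseʳ : ∀ x → fun e (fold x (fun e) k) ≡ x
  inverseʳ = e^K≗id

coreHomIso : ∀ {G H} → IsCore G → IsCore H → (f : Hom G H) → Hom H G → IsIso f
coreHomIso isCoreG isCoreH f g with coreEndoIso isCoreH (f ∘H g) | coreEndoIso isCoreG (g ∘H f)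
... | u , _ , fgu≗id | v , vgf≗id , _ = (g ∘H u) , inverseˡ , fgu≗id
  where
  open ≡-Reasoning
  inverseˡ : ∀ x → fun g (fun u (fun f x)) ≡ x
  inverseˡ x = begin
    fun g (fun u (fun f x))
      ≡⟨ vgf≗id _ ⟨
    fun v (fun g (fun f (fun g (fun u (fun f x)))))
      ≡⟨ cong (λ y → fun v (fun g y)) (fgu≗id (fun f x)) ⟩
    fun v (fun g (fun f x))
      ≡⟨ vgf≗id x ⟩
    x ∎

-- A homomorphism between graphs that map into each other is a weak
-- equivalence: the induced map of cores has a homomorphism back.
homEquiv⇒weakEq : ∀ {G H} (f : Hom G H) → Hom H G → WeakEq f
homEquiv⇒weakEq {G} {H} f g =
  coreOf G , coreOf H ,
  coreHomIso (isCoreOf (coreOf G)) (isCoreOf (coreOf H))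
             (r (coreOf H) ∘H (f ∘H s (coreOf G))) (r (coreOf G) ∘H (g ∘H s (coreOf H)))

weakEq⇒backHom : ∀ {G H} {w : Hom G H} → WeakEq w → Hom H G
weakEq⇒backHom (cG , cH , inverse , _) = s cG ∘H (inverse ∘H r cH)

module Double (G : Graph) where
  private
    n : ℕ
    n = V G

  edge : Fin n ⊎ Fin n → Fin n ⊎ Fin n → Bool
  edge (inj₁ a) (inj₁ b) = E G a b
  edge (inj₂ a) (inj₂ b) = E G a b
  edge (inj₁ a) (inj₂ b) = false
  edge (inj₂ a) (inj₁ b) = false

  edge-sym : ∀ x y → edge x y ≡ edge y x
  edge-sym (inj₁ a) (inj₁ b) = E-sym G a b
  edge-sym (inj₂ a) (inj₂ b) = E-sym G a b
  edge-sym (inj₁ a) (inj₂ b) = refl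
  edge-sym (inj₂ a) (inj₁ b) = refl

  G+G : Graph
  G+G = record
    { V = n + n
    ; E = λ i j → edge (splitAt n i) (splitAt n j)
    ; E-sym = λ i j → edge-sym (splitAt n i) (splitAt n j)
    }

  inl : Hom G G+G
  inl = hom (_↑ˡ n) λ i j e →
    subst₂ (λ u v → edge u v ≡ true) (sym (splitAt-↑ˡ n i n)) (sym (splitAt-↑ˡ n j n)) e

  inr : Hom G G+G
  inr = hom (n ↑ʳ_) λ i j e →
    subst₂ (λ u v → edge u v ≡ true) (sym (splitAt-↑ʳ n n i)) (sym (splitAt-↑ʳ n n j)) e

  copair : ∀ {D} → Hom G D → Hom G D → Hom G+G D
  copair {D} f g = hom (λ i → [ fun f , fun g ]′ (splitAt n i))
                       (λ i j → pres-copair (splitAt n i) (splitAt n j))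
    where
    pres-copair : ∀ x y → edge x y ≡ true →
                  E D ([ fun f , fun g ]′ x) ([ fun f , fun g ]′ y) ≡ true
    pres-copair (inj₁ a) (inj₁ b) e = pres f a b e
    pres-copair (inj₂ a) (inj₂ b) e = pres g a b e

  copair∘inl : ∀ {D} (f g : Hom G D) → (copair f g ∘H inl) ≗H f
  copair∘inl f g i = cong [ fun f , fun g ]′ (splitAt-↑ˡ n i n)

  copair∘inr : ∀ {D} (f g : Hom G D) → (copair f g ∘H inr) ≗H g
  copair∘inr f g i = cong [ fun f , fun g ]′ (splitAt-↑ʳ n n i)

  codiagonal : Hom G+G G
  codiagonal = copair idH idH

pathSetoid : Graph → Graph → Setoid _ _
pathSetoid A B = record
  { Carrier = Path A B
  ; _≈_ = _∼_
  ; isEquivalence = record { refl = ∼-refl ; sym = ∼-sym ; trans = ∼-trans }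
  }

section∼bwd : ∀ {X A} (w : Hom X A) (a : WeakEq w) (j : Hom A X) → (w ∘H j) ≗H idH →
              fwd j ∷ [] ∼ bwd w a ∷ []
section∼bwd {X} {A} w a j w∘j≗id = begin
  fwd j ∷ []                    ≈⟨ ∼-right (fwd j ∷ []) (inv₁ w a) ⟨
  fwd j ∷ fwd w ∷ bwd w a ∷ []  ≈⟨ ∼-left (bwd w a ∷ []) (fwd-∘ j w) ⟩
  fwd (w ∘H j) ∷ bwd w a ∷ []   ≈⟨ ∼-left (bwd w a ∷ []) (fwd-ext w∘j≗id) ⟩
  fwd idH ∷ bwd w a ∷ []        ≈⟨ ∼-left (bwd w a ∷ []) fwd-id ⟩
  bwd w a ∷ []                  ∎
  where open SetoidReasoning (pathSetoid A X)

-- Parallel homomorphisms are identified: both injections A → A + A are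
-- sections of the codiagonal, a weak equivalence, hence coincide.
fwd-thin : ∀ {A B} (f g : Hom A B) → fwd f ∷ [] ∼ fwd g ∷ []
fwd-thin {A} {B} f g = begin
  fwd f ∷ []                        ≈⟨ fwd-ext (copair∘inl f g) ⟨
  fwd (copair f g ∘H inl) ∷ []      ≈⟨ fwd-∘ inl (copair f g) ⟨
  fwd inl ∷ fwd (copair f g) ∷ []   ≈⟨ ∼-left (fwd (copair f g) ∷ []) inl∼inr ⟩
  fwd inr ∷ fwd (copair f g) ∷ []   ≈⟨ fwd-∘ inr (copair f g) ⟩
  fwd (copair f g ∘H inr) ∷ []      ≈⟨ fwd-ext (copair∘inr f g) ⟩
  fwd g ∷ []                        ∎
  where
  open Double A
  open SetoidReasoning (pathSetoid A B)
  ∇-weakEq : WeakEq codiagonal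
  ∇-weakEq = homEquiv⇒weakEq codiagonal inl
  inl∼inr : fwd inl ∷ [] ∼ fwd inr ∷ []
  inl∼inr = ∼-trans (section∼bwd codiagonal ∇-weakEq inl (copair∘inl idH idH))
                    (∼-sym (section∼bwd codiagonal ∇-weakEq inr (copair∘inr idH idH)))

bwd∼fwd : ∀ {G H} (w : Hom G H) (a : WeakEq w) (g : Hom H G) → bwd w a ∷ [] ∼ fwd g ∷ []
bwd∼fwd {G} {H} w a g = begin
  bwd w a ∷ []                   ≈⟨ ∼-right (bwd w a ∷ []) w-then-g ⟨
  bwd w a ∷ fwd w ∷ fwd g ∷ []   ≈⟨ ∼-left (fwd g ∷ []) (inv₂ w a) ⟩
  fwd g ∷ []                     ∎
  where
  open SetoidReasoning (pathSetoid H G)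
  w-then-g : fwd w ∷ fwd g ∷ [] ∼ []
  w-then-g = ∼-trans (fwd-∘ w g) (∼-trans (fwd-thin (g ∘H w) idH) fwd-id)

normalForm : ∀ {A B} (p : Path A B) → Σ (Hom A B) λ h → p ∼ fwd h ∷ []
normalForm [] = idH , ∼-sym fwd-id
normalForm (fwd f ∷ p) with normalForm p
... | h , p∼h = h ∘H f , ∼-trans (∼-right (fwd f ∷ []) p∼h) (fwd-∘ f h)
normalForm (bwd w a ∷ p) with normalForm p
... | h , p∼h = h ∘H g , ∼-trans (∼-right (bwd w a ∷ []) p∼h)
                          (∼-trans (∼-left (fwd h ∷ []) (bwd∼fwd w a g)) (fwd-∘ g h))
  where
  g : Hom _ _
  g = weakEq⇒backHom {w = w} a

paths-thin : ∀ {A B} (p q : Path A B) → p ∼ q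
paths-thin p q = ∼-trans (proj₂ (normalForm p))
                   (∼-trans (fwd-thin _ _) (∼-sym (proj₂ (normalForm q))))

toCores : Functor HoG GCore
toCores = record
  { F₀ = λ X → C (coreOf X) , isCoreOf (coreOf X)
  ; F₁ = λ {X} {Y} p → r (coreOf Y) ∘H (proj₁ (normalForm p) ∘H s (coreOf X))
  ; F-resp-≈ = λ _ → tt
  ; F-id = tt
  ; F-∘ = tt
  }

fromCores : Functor GCore HoG
fromCores = record
  { F₀ = proj₁
  ; F₁ = λ f → fwd f ∷ []
  ; F-resp-≈ = λ _ → fwd-thin _ _
  ; F-id = fwd-id
  ; F-∘ = paths-thin _ _
  }

-- Both round trips are given by retractions onto cores and their sections;
-- all coherence conditions hold because both categories are thin.
mainTheorem4 : Equivalence HoG GCore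
mainTheorem4 = record
  { F = toCores
  ; G = fromCores
  ; η = λ X → fwd (r (coreOf X)) ∷ []
  ; η⁻¹ = λ X → fwd (s (coreOf X)) ∷ []
  ; η-iso₁ = λ X → paths-thin _ _
  ; η-iso₂ = λ X → paths-thin _ _
  ; η-nat = λ f → paths-thin _ _
  ; ε = λ Y → s (coreOf (proj₁ Y))
  ; ε⁻¹ = λ Y → r (coreOf (proj₁ Y))
  ; ε-iso₁ = λ Y → tt
  ; ε-iso₂ = λ Y → tt
  ; ε-nat = λ f → tt
  }
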